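{- Let $S$ be a finite transformation semigroup on a finite set. Then there is a left-zero subsemigroup $S'\subseteq S$, all of whose elements have minimal rank among the elements of $S$, such that $\mathrm{Gr}(S)=\mathrm{Gr}(S')$.
   Context: Transformations act on the right; the rank of a transformation is the size of its image. A semigroup $T$ is left-zero if $ab=a$ for all $a,b\in T$. For a set $M$ of transformations of a finite set $V$, $\mathrm{Gr}(M)$ is the graph on $V$ in which distinct $v,w$ are adjacent iff there is no $f\in M$ with $vf=wf$. -}

module Defs where

open import Data.Nat using (ℕ; _≤_)
open import Data.Fin using (Fin; _≟_)
open import Data.Fin.Properties using (any?)
open import Data.Fin.Subset using (Subset; ∣_∣)
open import Data.Vec using (Vec; lookup; tabulate)
open import Data.List using (List)
open import Data.List.Membership.Propositional using (_∈_)
open import Data.Product using (∃; _×_)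
open import Relation.Binary.PropositionalEquality using (_≡_; _≢_)
open import Relation.Nullary using (¬_; does)

Transformation : ℕ → Set
Transformation n = Vec (Fin n) n

_·_ : ∀ {n} → Fin n → Transformation n → Fin n
v · f = lookup f v

_∘ᵣ_ : ∀ {n} → Transformation n → Transformation n → Transformation n
f ∘ᵣ g = tabulate (λ v → (v · f) · g)

image : ∀ {n} → Transformation n → Subset n
image f = tabulate (λ w → does (any? (λ v → v · f ≟ w)))

rank : ∀ {n} → Transformation n → ℕ
rank f = ∣ image f ∣

IsTransformationSemigroup : ∀ {n} → List (Transformation n) → Set
IsTransformationSemigroup S = ∀ {f g} → f ∈ S → g ∈ S → (f ∘ᵣ g) ∈ S

_⊆_ : ∀ {n} → List (Transformation n) → List (Transformation n) → Set
S' ⊆ S = ∀ {f} → f ∈ S' → f ∈ S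

IsLeftZero : ∀ {n} → List (Transformation n) → Set
IsLeftZero T = ∀ {a b} → a ∈ T → b ∈ T → (a ∘ᵣ b) ≡ a

-- Adjacency in Gr(M): distinct v, w with no f ∈ M such that v f = w f
GrAdj : ∀ {n} → List (Transformation n) → Fin n → Fin n → Set
GrAdj M v w = v ≢ w × ¬ (∃ λ f → f ∈ M × (v · f ≡ w · f))

-- Fix an idempotent e of minimal rank in S and let S' be the set of a ∈ S with
-- a e = a and e a = e; then a b = a e b = a e = a, so S' is left zero. If some
-- f ∈ S identifies v and w, so does g = f e, hence so does an idempotent power E
-- of g, and E e = E. As image E ⊆ image e and rank E ≥ rank e, the two images
-- coincide, so E fixes image e pointwise, i.e. e E = e. Thus E ∈ S', and S and S'
-- identify the same pairs of points, which is all that Gr depends on. Finally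
-- rank a = rank (a e) ≤ rank e for a ∈ S'.
module Submission where

open import Defs
open import Data.Bool using (true)
open import Data.Nat using (ℕ; zero; suc; _+_; _*_; _∸_; _≤_)
open import Data.Nat.Properties
  using (≤-trans; <⇒≱; n<1+n; n≤1+n; m≤m*n; +-suc; +-identityʳ; m∸n+n≡m; m≤n⇒∃[o]m+o≡n)
open import Data.Nat.Divisibility using (_∣_; divides; n∣m*n)
open import Data.Fin using (Fin; toℕ; _≟_)
open import Data.Fin.Properties using (any?; pigeonhole)
open import Data.Fin.Subset using (Subset; ∣_∣)
  renaming (_∈_ to _∈ₛ_; _⊆_ to _⊆ₛ_)
open import Data.Fin.Subset.Properties using (p⊆q⇒∣p∣≤∣q∣; p⊂q⇒∣p∣<∣q∣; _∈?_)
open import Data.Vec using (lookup; tabulate)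
open import Data.Vec.Properties using (lookup∘tabulate; tabulate∘lookup; tabulate-cong; lookup⇒[]=; []=⇒lookup; ≡-dec)
open import Data.List using (List; []; _∷_; filter; length)
open import Data.List.Membership.Propositional using (_∈_)
open import Data.List.Membership.Propositional.Properties using (∈-filter⁺; ∈-filter⁻)
open import Data.List.Membership.Setoid.Properties using (index-injective)
open import Data.List.Relation.Unary.All as All using ()
open import Data.List.Relation.Unary.Any using (here; index)
open import Data.List.Extrema.Nat using (argmin; argmin-all; f[argmin]≤f[xs])
open import Data.Product using (∃; ∃₂; _×_; _,_; proj₁)
open import Data.Product.Function.NonDependent.Propositional using (_×-⇔_)
open import Function using (id)
open import Function.Bundles using (_⇔_; mk⇔)
open import Function.Construct.Identity using (⇔-id)
open import Function.Related.TypeIsomorphisms using (¬-cong-⇔)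
open import Relation.Binary.PropositionalEquality
open import Relation.Nullary using (Dec; yes; no; does; contradiction)
open import Relation.Nullary.Decidable using (_×-dec_; dec-true)

∃-minimal-∈ : ∀ {a} {A : Set a} (f : A → ℕ) {x : A} {xs : List A} → x ∈ xs →
              ∃ λ m → m ∈ xs × (∀ {y} → y ∈ xs → f m ≤ f y)
∃-minimal-∈ f {x} {xs} x∈xs =
  argmin f x xs , argmin-all f x∈xs (All.tabulate id) , All.lookup (f[argmin]≤f[xs] x xs)

p⊆q∧∣q∣≤∣p∣⇒q⊆p : ∀ {m} {p q : Subset m} → p ⊆ₛ q → ∣ q ∣ ≤ ∣ p ∣ → q ⊆ₛ p
p⊆q∧∣q∣≤∣p∣⇒q⊆p {p = p} p⊆q ∣q∣≤∣p∣ {x} x∈q with x ∈? p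
... | yes x∈p = x∈p
... | no x∉p  = contradiction ∣q∣≤∣p∣ (<⇒≱ (p⊂q⇒∣p∣<∣q∣ (p⊆q , x , x∈q , x∉p)))

module _ {n : ℕ} where

  private
    T = Transformation n

  ·-∘ᵣ : ∀ (f g : T) v → v · (f ∘ᵣ g) ≡ (v · f) · g
  ·-∘ᵣ f g = lookup∘tabulate (λ u → (u · f) · g)

  ∘ᵣ-ext : ∀ {f g : T} → (∀ v → v · f ≡ v · g) → f ≡ g
  ∘ᵣ-ext {f} {g} f≗g = trans (sym (tabulate∘lookup f)) (trans (tabulate-cong f≗g) (tabulate∘lookup g))

  ∘ᵣ-assoc : ∀ (f g h : T) → (f ∘ᵣ g) ∘ᵣ h ≡ f ∘ᵣ (g ∘ᵣ h)
  ∘ᵣ-assoc f g h = ∘ᵣ-ext λ v → begin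
      v · ((f ∘ᵣ g) ∘ᵣ h)  ≡⟨ ·-∘ᵣ (f ∘ᵣ g) h v ⟩
      (v · (f ∘ᵣ g)) · h   ≡⟨ cong (_· h) (·-∘ᵣ f g v) ⟩
      ((v · f) · g) · h    ≡⟨ sym (·-∘ᵣ g h (v · f)) ⟩
      (v · f) · (g ∘ᵣ h)   ≡⟨ sym (·-∘ᵣ f (g ∘ᵣ h) v) ⟩
      v · (f ∘ᵣ (g ∘ᵣ h))  ∎
    where open ≡-Reasoning

  identity : T
  identity = tabulate id

  ∘ᵣ-identityˡ : ∀ (f : T) → identity ∘ᵣ f ≡ f
  ∘ᵣ-identityˡ f = ∘ᵣ-ext λ v →
    trans (·-∘ᵣ identity f v) (cong (_· f) (lookup∘tabulate id v))

  ∘ᵣ-identityʳ : ∀ (f : T) → f ∘ᵣ identity ≡ f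
  ∘ᵣ-identityʳ f = ∘ᵣ-ext λ v → trans (·-∘ᵣ f identity v) (lookup∘tabulate id (v · f))

  RightNeutral : T → T → Set
  RightNeutral e a = a ∘ᵣ e ≡ a

  IsIdempotent : T → Set
  IsIdempotent e = RightNeutral e e

  rightNeutral-∘ᵣˡ : ∀ {e a} (h : T) → RightNeutral e a → RightNeutral e (h ∘ᵣ a)
  rightNeutral-∘ᵣˡ {e} {a} h ae≡a = trans (∘ᵣ-assoc h a e) (cong (h ∘ᵣ_) ae≡a)

  rightNeutral-∘ᵣ : ∀ {e e′ a : T} → RightNeutral e a → RightNeutral e′ a → RightNeutral (e ∘ᵣ e′) a
  rightNeutral-∘ᵣ {e} {e′} {a} ae≡a ae′≡a =
    trans (sym (∘ᵣ-assoc a e e′)) (trans (cong (_∘ᵣ e′) ae≡a) ae′≡a)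

  ∘ᵣ-through : ∀ {a b e : T} → RightNeutral e a → RightNeutral b e → a ∘ᵣ b ≡ a
  ∘ᵣ-through {a} {b} {e} ae≡a eb≡e = begin
    a ∘ᵣ b          ≡⟨ cong (_∘ᵣ b) (sym ae≡a) ⟩
    (a ∘ᵣ e) ∘ᵣ b   ≡⟨ ∘ᵣ-assoc a e b ⟩
    a ∘ᵣ (e ∘ᵣ b)   ≡⟨ cong (a ∘ᵣ_) eb≡e ⟩
    a ∘ᵣ e          ≡⟨ ae≡a ⟩
    a               ∎
    where open ≡-Reasoning

  leftZero⇒closed : ∀ {S : List T} → IsLeftZero S → IsTransformationSemigroup S
  leftZero⇒closed leftZero {f} f∈S g∈S = subst (_∈ _) (sym (leftZero f∈S g∈S)) f∈S

  ∈-image⁺ : ∀ (f : T) v → v · f ∈ₛ image f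
  ∈-image⁺ f v = lookup⇒[]= (v · f) (image f)
    (trans (lookup∘tabulate _ (v · f)) (dec-true (any? (λ u → u · f ≟ v · f)) (v , refl)))

  ∈-image⁻ : ∀ (f : T) {x} → x ∈ₛ image f → ∃ λ v → v · f ≡ x
  ∈-image⁻ f {x} x∈f = witness (any? (λ u → u · f ≟ x))
    (trans (sym (lookup∘tabulate _ x)) ([]=⇒lookup x∈f))
    where
    witness : (u? : Dec (∃ λ u → u · f ≡ x)) → does u? ≡ true → ∃ λ u → u · f ≡ x
    witness (yes u) _  = u
    witness (no _)  ()

  image-∘ᵣ⊆ : ∀ (f g : T) → image (f ∘ᵣ g) ⊆ₛ image g
  image-∘ᵣ⊆ f g x∈fg with ∈-image⁻ (f ∘ᵣ g) x∈fg
  ... | v , refl = subst (_∈ₛ image g) (sym (·-∘ᵣ f g v)) (∈-image⁺ g (v · f))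

  rank-∘ᵣ≤ : ∀ (f g : T) → rank (f ∘ᵣ g) ≤ rank g
  rank-∘ᵣ≤ f g = p⊆q⇒∣p∣≤∣q∣ (image-∘ᵣ⊆ f g)

  idempotent⇒fixes-image : ∀ {e : T} → IsIdempotent e → ∀ {x} → x ∈ₛ image e → x · e ≡ x
  idempotent⇒fixes-image {e} ee≡e x∈e with ∈-image⁻ e x∈e
  ... | v , refl = trans (sym (·-∘ᵣ e e v)) (cong (v ·_) ee≡e)

  rightNeutral-flip : ∀ {a e : T} → IsIdempotent a → RightNeutral e a → rank e ≤ rank a →
                      RightNeutral a e
  rightNeutral-flip {a} {e} aa≡a ae≡a rank-e≤rank-a = ∘ᵣ-ext λ v →
    trans (·-∘ᵣ e a v) (idempotent⇒fixes-image aa≡a (image-e⊆image-a (∈-image⁺ e v)))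
    where
    image-a⊆image-e : image a ⊆ₛ image e
    image-a⊆image-e = subst (λ b → image b ⊆ₛ image e) ae≡a (image-∘ᵣ⊆ a e)
    image-e⊆image-a : image e ⊆ₛ image a
    image-e⊆image-a = p⊆q∧∣q∣≤∣p∣⇒q⊆p image-a⊆image-e rank-e≤rank-a

  infixr 25 _^_
  _^_ : T → ℕ → T
  g ^ zero  = identity
  g ^ suc k = g ^ k ∘ᵣ g

  ^-+ : ∀ (g : T) a b → g ^ (a + b) ≡ g ^ a ∘ᵣ g ^ b
  ^-+ g a zero    = trans (cong (g ^_) (+-identityʳ a)) (sym (∘ᵣ-identityʳ (g ^ a)))
  ^-+ g a (suc b) = begin
    g ^ (a + suc b)            ≡⟨ cong (g ^_) (+-suc a b) ⟩
    g ^ (a + b) ∘ᵣ g           ≡⟨ cong (_∘ᵣ g) (^-+ g a b) ⟩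
    (g ^ a ∘ᵣ g ^ b) ∘ᵣ g      ≡⟨ ∘ᵣ-assoc (g ^ a) (g ^ b) g ⟩
    g ^ a ∘ᵣ g ^ suc b         ∎
    where open ≡-Reasoning

  ^-suc-∈ : ∀ {S : List T} → IsTransformationSemigroup S → ∀ {g} → g ∈ S → ∀ k → g ^ suc k ∈ S
  ^-suc-∈ closed {g} g∈S zero    = subst (_∈ _) (sym (∘ᵣ-identityˡ g)) g∈S
  ^-suc-∈ closed     g∈S (suc k) = closed (^-suc-∈ closed g∈S k) g∈S

  rank-^-suc≤ : ∀ (g : T) k → rank (g ^ suc k) ≤ rank g
  rank-^-suc≤ g k = rank-∘ᵣ≤ (g ^ k) g

  rightNeutral-^-suc : ∀ {e g : T} → RightNeutral e g → ∀ k → RightNeutral e (g ^ suc k)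
  rightNeutral-^-suc {e} {g} ge≡g k = rightNeutral-∘ᵣˡ {e} {g} (g ^ k) ge≡g

  ^-suc-identifies : ∀ {g : T} {v w} → v · g ≡ w · g → ∀ k → v · (g ^ suc k) ≡ w · (g ^ suc k)
  ^-suc-identifies {g} {v} {w} vg≡wg zero = subst (λ h → v · h ≡ w · h) (sym (∘ᵣ-identityˡ g)) vg≡wg
  ^-suc-identifies {g} {v} {w} vg≡wg (suc k) = begin
    v · (g ^ suc k ∘ᵣ g)  ≡⟨ ·-∘ᵣ (g ^ suc k) g v ⟩
    (v · g ^ suc k) · g   ≡⟨ cong (_· g) (^-suc-identifies {g} vg≡wg k) ⟩
    (w · g ^ suc k) · g   ≡⟨ sym (·-∘ᵣ (g ^ suc k) g w) ⟩
    w · (g ^ suc k ∘ᵣ g)  ∎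
    where open ≡-Reasoning

  rightNeutral-^-multiple : ∀ {g a : T} {p m} → p ∣ m → RightNeutral (g ^ p) a → RightNeutral (g ^ m) a
  rightNeutral-^-multiple {g} {a} {p} (divides q refl) ag^p≡a = multiple q
    where
    multiple : ∀ q → RightNeutral (g ^ (q * p)) a
    multiple zero    = ∘ᵣ-identityʳ a
    multiple (suc q) = subst (λ h → RightNeutral h a) (sym (^-+ g p (q * p)))
                         (rightNeutral-∘ᵣ {g ^ p} {g ^ (q * p)} ag^p≡a (multiple q))

  periodic⇒idempotent : ∀ {g : T} {i p k} → RightNeutral (g ^ p) (g ^ i) → i ≤ k → p ∣ k →
                        IsIdempotent (g ^ k)
  periodic⇒idempotent {g} {i} {p} {k} periodic i≤k p∣k = rightNeutral-^-multiple p∣k periodic-from-k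
    where
    g^k-splits : g ^ (k ∸ i) ∘ᵣ g ^ i ≡ g ^ k
    g^k-splits = trans (sym (^-+ g (k ∸ i) i)) (cong (g ^_) (m∸n+n≡m i≤k))
    periodic-from-k : RightNeutral (g ^ p) (g ^ k)
    periodic-from-k = subst (RightNeutral (g ^ p)) g^k-splits
                        (rightNeutral-∘ᵣˡ {g ^ p} {g ^ i} (g ^ (k ∸ i)) periodic)

  eventually-periodic : ∀ {S : List T} → IsTransformationSemigroup S → ∀ {g} → g ∈ S →
                        ∃₂ λ i d → RightNeutral (g ^ suc d) (g ^ i)
  eventually-periodic {S} closed {g} g∈S
    with i , j , i<j , same-index ← pigeonhole (n<1+n (length S)) (λ k → index (^-suc-∈ closed g∈S (toℕ k)))
    with d , i+d≡j ← m≤n⇒∃[o]m+o≡n i<j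
    = suc (toℕ i) , d , (begin
      g ^ suc (toℕ i) ∘ᵣ g ^ suc d  ≡⟨ sym (^-+ g (suc (toℕ i)) (suc d)) ⟩
      g ^ (suc (toℕ i) + suc d)     ≡⟨ cong (g ^_) (trans (+-suc (suc (toℕ i)) d) (cong suc i+d≡j)) ⟩
      g ^ suc (toℕ j)               ≡⟨ index-injective (setoid T) (g^suc∈S (toℕ j)) (g^suc∈S (toℕ i))
                                         (sym same-index) ⟩
      g ^ suc (toℕ i)               ∎)
    where
    open ≡-Reasoning
    g^suc∈S : ∀ k → g ^ suc k ∈ S
    g^suc∈S = ^-suc-∈ closed g∈S

  idempotent-power : ∀ {S : List T} → IsTransformationSemigroup S → ∀ {g} → g ∈ S →
                     ∃ λ k → IsIdempotent (g ^ suc k)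
  -- The exponent suc (d + i * suc d) is suc i * suc d by definition.
  idempotent-power closed g∈S with i , d , periodic ← eventually-periodic closed g∈S
    = d + i * suc d , periodic⇒idempotent periodic i≤k (n∣m*n (suc i))
    where
    i≤k : i ≤ suc i * suc d
    i≤k = ≤-trans (n≤1+n i) (m≤m*n (suc i) (suc d))

  minimal-rank-idempotent : ∀ {S : List T} → IsTransformationSemigroup S → ∀ {g} → g ∈ S →
                            ∃ λ e → e ∈ S × IsIdempotent e × (∀ {h} → h ∈ S → rank e ≤ rank h)
  minimal-rank-idempotent closed g∈S =
    let m , m∈S , m-minimal = ∃-minimal-∈ rank g∈S
        k , idempotent = idempotent-power closed m∈S
    in m ^ suc k , ^-suc-∈ closed m∈S k , idempotent ,
       λ h∈S → ≤-trans (rank-^-suc≤ m k) (m-minimal h∈S)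

  Identifies : List T → Fin n → Fin n → Set
  Identifies M v w = ∃ λ f → f ∈ M × (v · f ≡ w · f)

  GrAdj-⇔ : ∀ {M M′ : List T} {v w} → Identifies M v w ⇔ Identifies M′ v w →
            GrAdj M v w ⇔ GrAdj M′ v w
  GrAdj-⇔ identifies-⇔ = ⇔-id _ ×-⇔ ¬-cong-⇔ identifies-⇔

  module MinimalIdempotent {S : List T} (closed : IsTransformationSemigroup S)
                           {e : T} (e∈S : e ∈ S) (ee≡e : IsIdempotent e)
                           (e-minimal : ∀ {h} → h ∈ S → rank e ≤ rank h) where

    MutuallyRightNeutral : T → Set
    MutuallyRightNeutral a = RightNeutral e a × RightNeutral a e

    mutuallyRightNeutral? : ∀ a → Dec (MutuallyRightNeutral a)
    mutuallyRightNeutral? a = ≡-dec _≟_ (a ∘ᵣ e) a ×-dec ≡-dec _≟_ (e ∘ᵣ a) e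

    S′ : List T
    S′ = filter mutuallyRightNeutral? S

    ∈-S′⁻ : ∀ {a} → a ∈ S′ → a ∈ S × MutuallyRightNeutral a
    ∈-S′⁻ = ∈-filter⁻ mutuallyRightNeutral? {xs = S}

    S′⊆S : S′ ⊆ S
    S′⊆S a∈S′ = proj₁ (∈-S′⁻ a∈S′)

    S′-leftZero : IsLeftZero S′
    S′-leftZero {a} {b} a∈S′ b∈S′ =
      let _ , ae≡a , _  = ∈-S′⁻ a∈S′
          _ , _ , eb≡e = ∈-S′⁻ b∈S′
      in ∘ᵣ-through {a} {b} {e} ae≡a eb≡e

    S′-minimal : ∀ {a h} → a ∈ S′ → h ∈ S → rank a ≤ rank h
    S′-minimal {a} a∈S′ h∈S =
      let _ , ae≡a , _ = ∈-S′⁻ a∈S′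
      in ≤-trans (subst (λ b → rank b ≤ rank e) ae≡a (rank-∘ᵣ≤ a e)) (e-minimal h∈S)

    identifies-S⇒S′ : ∀ {v w} → Identifies S v w → Identifies S′ v w
    identifies-S⇒S′ {v} {w} (f , f∈S , vf≡wf) =
      let k , EE≡E = idempotent-power closed g∈S
          E∈S = ^-suc-∈ closed g∈S k
          Ee≡E = rightNeutral-^-suc {e} {g} (rightNeutral-∘ᵣˡ {e} {e} f ee≡e) k
      in g ^ suc k , ∈-filter⁺ mutuallyRightNeutral? E∈S (Ee≡E , rightNeutral-flip EE≡E Ee≡E (e-minimal E∈S))
                   , ^-suc-identifies {g} vg≡wg k
      where
      g = f ∘ᵣ e
      g∈S = closed f∈S e∈S
      vg≡wg : v · g ≡ w · g
      vg≡wg = trans (·-∘ᵣ f e v) (trans (cong (_· e) vf≡wf) (sym (·-∘ᵣ f e w)))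

    GrAdj-S⇔S′ : ∀ v w → GrAdj S v w ⇔ GrAdj S′ v w
    GrAdj-S⇔S′ v w = GrAdj-⇔ (mk⇔ identifies-S⇒S′ λ (a , a∈S′ , va≡wa) → a , S′⊆S a∈S′ , va≡wa)

mainTheorem14 : (n : ℕ) (S : List (Transformation n)) → IsTransformationSemigroup S →
    ∃ λ (S' : List (Transformation n)) →
      S' ⊆ S × IsTransformationSemigroup S' × IsLeftZero S'
      × (∀ {f g} → f ∈ S' → g ∈ S → rank f ≤ rank g)
      × (∀ v w → GrAdj S v w ⇔ GrAdj S' v w)
mainTheorem14 n []      closed = [] , id , closed , (λ ()) , (λ ()) , λ _ _ → ⇔-id _
mainTheorem14 n (g ∷ S) closed =
  let e , e∈S , ee≡e , e-minimal = minimal-rank-idempotent closed (here refl)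
      open MinimalIdempotent closed e∈S ee≡e e-minimal
  in S′ , S′⊆S , leftZero⇒closed S′-leftZero , S′-leftZero , S′-minimal , GrAdj-S⇔S′
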